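{- Let $\Gamma$ be an inductive relator for $T$ that respects $\Sigma$, and let $\precsim^H_\Gamma=(\precsim^H_{\mathcal T},\precsim^H_{\mathcal V})$ be the Howe extension of applicative $\Gamma$-similarity. Then its restriction to closed terms and closed values is an applicative $\Gamma$-simulation.
   Context: A signature $\Sigma$: operation symbols with finite arities. An $\omega$CPPO is a poset with least element $\bot$ and lubs of $\omega$-chains. $T$ is a monad on sets (unit $\eta$, bind $\gg\!=$) with each $TX$ an $\omega$CPPO, bind continuous in both arguments, and each $\sigma$ of arity $k$ interpreted as a continuous $\sigma^T:(TX)^k\to TX$. Terms/values: $M,N ::= \mathsf{return}\,V\mid VW\mid M\ \mathsf{to}\ x.N\mid\sigma(M_1,\dots,M_k)$, $V,W::=x\mid\lambda x.M$. Judgments $M\Downarrow_n X$: $M\Downarrow_0\bot$; $\mathsf{return}\,V\Downarrow_{n+1}\eta(V)$; $M[V/x]\Downarrow_n X\Rightarrow(\lambda x.M)V\Downarrow_{n+1}X$; $M\Downarrow_nX$, $N[V/x]\Downarrow_nY_V$ (all closed $V$) $\Rightarrow(M\ \mathsf{to}\ x.N)\Downarrow_{n+1}X\gg\!=(V\mapsto Y_V)$; $M_i\Downarrow_nX_i\Rightarrow\sigma(\bar M)\Downarrow_{n+1}\sigma^T(\bar X)$. $[\![M]\!]$ is the lub of the resulting $\omega$-chain. Relator for $T$: $R\subseteq X\times Y\mapsto\Gamma R\subseteq TX\times TY$ with $=_{TX}\subseteq\Gamma(=_X)$, $\Gamma S\circ\Gamma R\subseteq\Gamma(S\circ R)$,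 $\Gamma((f\times g)^{ -1}R)=(Tf\times Tg)^{ -1}\Gamma R$, monotone, $x\,R\,y\Rightarrow\eta(x)\,\Gamma R\,\eta(y)$, and ($x\,R\,y\Rightarrow f(x)\,\Gamma S\,g(y)$) implies ($u\,\Gamma R\,v\Rightarrow(u\gg\!=f)\,\Gamma S\,(v\gg\!=g)$). Inductive: $\bot\,\Gamma R\,v$ always and $\Gamma R$ closed under lubs of $\omega$-chains on the left. Respects $\Sigma$: $\sigma^T$ preserves componentwise $\Gamma R$-relatedness. Applicative $\Gamma$-simulation: closed $(R_{\mathcal T},R_{\mathcal V})$ with $M\,R_{\mathcal T}\,N\Rightarrow[\![M]\!]\,\Gamma R_{\mathcal V}\,[\![N]\!]$ and $V\,R_{\mathcal V}\,W\Rightarrow VU\,R_{\mathcal T}\,WU$ for all closed values $U$; applicative similarity is the largest one. Open extension $R^\circ$: $\bar x\vdash M\,R^\circ\,N$ iff $M[\bar V/\bar x]\,R\,N[\bar V/\bar x]$ for all closed values $\bar V$. Compatible refinement $\widehat S$: $\bar x\vdash x\,\widehat S\,x$; $\bar x\cup\{x\}\vdash M\,S\,N\Rightarrow\bar x\vdash\lambda x.M\,\widehat S\,\lambda x.N$; $V\,S\,W\Rightarrow\mathsf{return}\,V\,\widehat S\,\mathsf{return}\,W$; $V\,S\,V',W\,S\,W'\Rightarrow VW\,\widehat S\,V'W'$; $\bar x\vdash M\,S\,M'$, $\bar x\cup\{x\}\vdash N\,S\,N'\Rightarrow M\ \mathsf{to}\ x.N\,\widehat S\,M'\ \mathsf{to}\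 x.N'$; $M_i\,S\,N_i\ (\forall i)\Rightarrow\sigma(\bar M)\,\widehat S\,\sigma(\bar N)$ (all under the same $\bar x$ unless stated). Howe extension $R^H$ of a closed $R$: least $S$ with $\bar x\vdash M\,S\,N$ iff $\exists L.\ \bar x\vdash M\,\widehat S\,L$ and $\bar x\vdash L\,R^\circ\,N$. -}

module Defs where

open import Level using (Level; _⊔_; Setω) renaming (zero to lzero; suc to lsuc)
open import Data.Nat using (ℕ; zero; suc)
open import Data.Fin using (Fin; zero; suc)
open import Data.Product using (Σ; ∃; _×_; _,_)
open import Relation.Binary.PropositionalEquality using (_≡_)
open import Relation.Binary.Core using (REL; Rel)

record Signature : Set₁ where
  field
    Op    : Set
    arity : Op → ℕ

record ωCPPO (A : Set) : Set₁ where
  infix 4 _⊑_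
  field
    _⊑_      : A → A → Set
    ⊑-refl   : ∀ {x} → x ⊑ x
    ⊑-trans  : ∀ {x y z} → x ⊑ y → y ⊑ z → x ⊑ z
    ⊑-antisym : ∀ {x y} → x ⊑ y → y ⊑ x → x ≡ y
    ⊥        : A
    ⊥-least  : ∀ {x} → ⊥ ⊑ x
    ⨆        : (c : ℕ → A) → (∀ n → c n ⊑ c (suc n)) → A
    ⨆-upper  : ∀ c p n → c n ⊑ ⨆ c p
    ⨆-least  : ∀ c p {x} → (∀ n → c n ⊑ x) → ⨆ c p ⊑ x

record Monad : Set₁ where
  infixl 1 _>>=_
  field
    T      : Set → Set
    η      : ∀ {X} → X → T X
    _>>=_  : ∀ {X Y} → T X → (X → T Y) → T Y
    >>=-unitˡ : ∀ {X Y} (x : X) (f : X → T Y) → (η x >>= f) ≡ f x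
    >>=-unitʳ : ∀ {X} (u : T X) → (u >>= η) ≡ u
    >>=-assoc : ∀ {X Y Z} (u : T X) (f : X → T Y) (g : Y → T Z) →
                ((u >>= f) >>= g) ≡ (u >>= λ x → f x >>= g)

  fmap : ∀ {X Y} → (X → Y) → T X → T Y
  fmap f u = u >>= λ x → η (f x)

record Model (Sg : Signature) : Set₁ where
  open Signature Sg
  field
    monad : Monad
  open Monad monad public
  field
    cpo : ∀ X → ωCPPO (T X)

  module C X = ωCPPO (cpo X)

  field
    bind-mono₁ : ∀ {X Y} {u v : T X} (f : X → T Y) →
                 C._⊑_ X u v → C._⊑_ Y (u >>= f) (v >>= f)
    bind-lub₁  : ∀ {X Y} (c : ℕ → T X) (p : ∀ n → C._⊑_ X (c n) (c (suc n)))
                 (f : X → T Y) →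
                 (C.⨆ X c p >>= f) ≡ C.⨆ Y (λ n → c n >>= f) (λ n → bind-mono₁ f (p n))
    bind-mono₂ : ∀ {X Y} (u : T X) {f g : X → T Y} →
                 (∀ x → C._⊑_ Y (f x) (g x)) → C._⊑_ Y (u >>= f) (u >>= g)
    bind-lub₂  : ∀ {X Y} (u : T X) (c : ℕ → X → T Y)
                 (p : ∀ n x → C._⊑_ Y (c n x) (c (suc n) x)) →
                 (u >>= λ x → C.⨆ Y (λ n → c n x) (λ n → p n x))
                   ≡ C.⨆ Y (λ n → u >>= c n) (λ n → bind-mono₂ u (p n))
    opT      : ∀ {X} (o : Op) → (Fin (arity o) → T X) → T X
    opT-mono : ∀ {X} (o : Op) {xs ys : Fin (arity o) → T X} →
               (∀ i → C._⊑_ X (xs i) (ys i)) → C._⊑_ X (opT o xs) (opT o ys)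
    opT-lub  : ∀ {X} (o : Op) (c : ℕ → Fin (arity o) → T X)
               (p : ∀ n i → C._⊑_ X (c n i) (c (suc n) i)) →
               opT o (λ i → C.⨆ X (λ n → c n i) (λ n → p n i))
                 ≡ C.⨆ X (λ n → opT o (c n)) (λ n → opT-mono o (p n))

module Syntax (Sg : Signature) where
  open Signature Sg

  mutual
    data Val (n : ℕ) : Set where
      var : Fin n → Val n
      lam : Term (suc n) → Val n

    data Term (n : ℕ) : Set where
      ret  : Val n → Term n
      app  : Val n → Val n → Term n
      _to_ : Term n → Term (suc n) → Term n
      op   : (o : Op) → (Fin (arity o) → Term n) → Term n

  ext : ∀ {m n} → (Fin m → Fin n) → Fin (suc m) → Fin (suc n)
  ext ρ zero    = zero
  ext ρ (suc i) = suc (ρ i)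

  mutual
    renV : ∀ {m n} → (Fin m → Fin n) → Val m → Val n
    renV ρ (var x) = var (ρ x)
    renV ρ (lam M) = lam (ren (ext ρ) M)

    ren : ∀ {m n} → (Fin m → Fin n) → Term m → Term n
    ren ρ (ret V)    = ret (renV ρ V)
    ren ρ (app V W)  = app (renV ρ V) (renV ρ W)
    ren ρ (M to N)   = ren ρ M to ren (ext ρ) N
    ren ρ (op o Ms)  = op o (λ i → ren ρ (Ms i))

  exts : ∀ {m n} → (Fin m → Val n) → Fin (suc m) → Val (suc n)
  exts σ zero    = var zero
  exts σ (suc i) = renV suc (σ i)

  mutual
    substV : ∀ {m n} → (Fin m → Val n) → Val m → Val n
    substV σ (var x) = σ x
    substV σ (lam M) = lam (subst (exts σ) M)

    subst : ∀ {m n} → (Fin m → Val n) → Term m → Term n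
    subst σ (ret V)   = ret (substV σ V)
    subst σ (app V W) = app (substV σ V) (substV σ W)
    subst σ (M to N)  = subst σ M to subst (exts σ) N
    subst σ (op o Ms) = op o (λ i → subst σ (Ms i))

  _[_] : ∀ {n} → Term (suc n) → Val n → Term n
  M [ V ] = subst (λ { zero → V ; (suc i) → var i }) M

module Semantics {Sg : Signature} (𝕄 : Model Sg) where
  open Signature Sg
  open Syntax Sg public
  open Model 𝕄

  TV : Set
  TV = T (Val 0)

  open ωCPPO (cpo (Val 0)) using (_⊑_; ⊑-refl; ⊑-trans; ⊥; ⊥-least; ⨆)

  -- M ⇓ₙ X  (the judgment is deterministic: eval n M is the unique X)
  eval : ℕ → Term 0 → TV
  eval zero    M                = ⊥
  eval (suc n) (ret V)          = η V
  eval (suc n) (app (lam M) W)  = eval n (M [ W ])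
  eval (suc n) (M to N)         = eval n M >>= λ V → eval n (N [ V ])
  eval (suc n) (op o Ms)        = opT o (λ i → eval n (Ms i))

  eval-chain : ∀ n M → eval n M ⊑ eval (suc n) M
  eval-chain zero    M               = ⊥-least
  eval-chain (suc n) (ret V)         = ⊑-refl
  eval-chain (suc n) (app (lam M) W) = eval-chain n (M [ W ])
  eval-chain (suc n) (M to N)        =
    ⊑-trans (bind-mono₁ _ (eval-chain n M))
            (bind-mono₂ _ (λ V → eval-chain n (N [ V ])))
  eval-chain (suc n) (op o Ms)       = opT-mono o (λ i → eval-chain n (Ms i))

  ⟦_⟧ : Term 0 → TV
  ⟦ M ⟧ = ⨆ (λ n → eval n M) (λ n → eval-chain n M)

  -- relational composition S ∘ R (first R, then S)
  _∘ᴿ_ : ∀ {ℓ₁ ℓ₂} {X Y Z : Set} → REL Y Z ℓ₂ → REL X Y ℓ₁ → REL X Z (ℓ₁ ⊔ ℓ₂)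
  (S ∘ᴿ R) x z = ∃ λ y → R x y × S y z

  record Relator : Setω where
    field
      Γ : ∀ {ℓ} {X Y : Set} → REL X Y ℓ → REL (T X) (T Y) ℓ
      Γ-refl  : ∀ {X : Set} (u : T X) → Γ (_≡_ {A = X}) u u
      Γ-comp  : ∀ {ℓ₁ ℓ₂} {X Y Z : Set} {R : REL X Y ℓ₁} {S : REL Y Z ℓ₂}
                {u v w} → Γ R u v → Γ S v w → Γ (S ∘ᴿ R) u w
      Γ-inv⇒  : ∀ {ℓ} {X X' Y Y' : Set} (f : X → X') (g : Y → Y') (R : REL X' Y' ℓ)
                {u v} → Γ (λ x y → R (f x) (g y)) u v → Γ R (fmap f u) (fmap g v)
      Γ-inv⇐  : ∀ {ℓ} {X X' Y Y' : Set} (f : X → X') (g : Y → Y') (R : REL X' Y' ℓ)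
                {u v} → Γ R (fmap f u) (fmap g v) → Γ (λ x y → R (f x) (g y)) u v
      Γ-mono  : ∀ {ℓ ℓ'} {X Y : Set} {R : REL X Y ℓ} {R' : REL X Y ℓ'} →
                (∀ {x y} → R x y → R' x y) → ∀ {u v} → Γ R u v → Γ R' u v
      Γ-η     : ∀ {ℓ} {X Y : Set} {R : REL X Y ℓ} {x y} → R x y → Γ R (η x) (η y)
      Γ-bind  : ∀ {ℓ ℓ'} {X Y X' Y' : Set} {R : REL X Y ℓ} {S : REL X' Y' ℓ'}
                (f : X → T X') (g : Y → T Y') →
                (∀ {x y} → R x y → Γ S (f x) (g y)) →
                ∀ {u v} → Γ R u v → Γ S (u >>= f) (v >>= g)

  module _ (Γr : Relator) where
    open Relator Γr

    record Inductive : Setω where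
      field
        Γ-⊥   : ∀ {ℓ} {X Y : Set} {R : REL X Y ℓ} (v : T Y) → Γ R (C.⊥ X) v
        Γ-lub : ∀ {ℓ} {X Y : Set} {R : REL X Y ℓ} (c : ℕ → T X)
                (p : ∀ n → C._⊑_ X (c n) (c (suc n))) (v : T Y) →
                (∀ n → Γ R (c n) v) → Γ R (C.⨆ X c p) v

    RespectsΣ : Setω
    RespectsΣ = ∀ {ℓ} {X Y : Set} {R : REL X Y ℓ} (o : Op)
                  (xs : Fin (arity o) → T X) (ys : Fin (arity o) → T Y) →
                  (∀ i → Γ R (xs i) (ys i)) → Γ R (opT o xs) (opT o ys)

    record IsAppSim {ℓ} (RT : Rel (Term 0) ℓ) (RV : Rel (Val 0) ℓ) : Set ℓ where
      field
        sim-term : ∀ {M N} → RT M N → Γ RV ⟦ M ⟧ ⟦ N ⟧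
        sim-val  : ∀ {V W} → RV V W → ∀ (U : Val 0) → RT (app V U) (app W U)

    -- applicative Γ-similarity: the largest applicative Γ-simulation,
    -- i.e. the union of all applicative Γ-simulations
    _≾T_ : Rel (Term 0) (lsuc lzero)
    M ≾T N = Σ (Rel (Term 0) lzero) λ RT → Σ (Rel (Val 0) lzero) λ RV →
               IsAppSim RT RV × RT M N

    _≾V_ : Rel (Val 0) (lsuc lzero)
    V ≾V W = Σ (Rel (Term 0) lzero) λ RT → Σ (Rel (Val 0) lzero) λ RV →
               IsAppSim RT RV × RV V W

  OpenRelT : ∀ ℓ → Set (lsuc ℓ)
  OpenRelT ℓ = ∀ n → Rel (Term n) ℓ

  OpenRelV : ∀ ℓ → Set (lsuc ℓ)
  OpenRelV ℓ = ∀ n → Rel (Val n) ℓ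

  _°T : ∀ {ℓ} → Rel (Term 0) ℓ → OpenRelT ℓ
  (R °T) n M N = ∀ (ρ : Fin n → Val 0) → R (subst ρ M) (subst ρ N)

  _°V : ∀ {ℓ} → Rel (Val 0) ℓ → OpenRelV ℓ
  (R °V) n V W = ∀ (ρ : Fin n → Val 0) → R (substV ρ V) (substV ρ W)

  data CompV {ℓ} (ST : OpenRelT ℓ) (SV : OpenRelV ℓ) : OpenRelV ℓ where
    c-var : ∀ {n} (x : Fin n) → CompV ST SV n (var x) (var x)
    c-lam : ∀ {n M N} → ST (suc n) M N → CompV ST SV n (lam M) (lam N)

  data CompT {ℓ} (ST : OpenRelT ℓ) (SV : OpenRelV ℓ) : OpenRelT ℓ where
    c-ret : ∀ {n V W} → SV n V W → CompT ST SV n (ret V) (ret W)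
    c-app : ∀ {n V V' W W'} → SV n V V' → SV n W W' →
            CompT ST SV n (app V W) (app V' W')
    c-to  : ∀ {n M M' N N'} → ST n M M' → ST (suc n) N N' →
            CompT ST SV n (M to N) (M' to N')
    c-op  : ∀ {n} (o : Op) {Ms Ns : Fin (arity o) → Term n} →
            (∀ i → ST n (Ms i) (Ns i)) → CompT ST SV n (op o Ms) (op o Ns)

  -- Howe extension R^H of a closed R = (RT , RV): the least S with
  --   x̄ ⊢ M S N  iff  ∃ L. x̄ ⊢ M Ŝ L and x̄ ⊢ L R° N
  module Howe {ℓ} (RT : Rel (Term 0) ℓ) (RV : Rel (Val 0) ℓ) where
    mutual
      data HoweT : OpenRelT ℓ where
        howeT : ∀ {n M L N} → CompT HoweT HoweV n M L → (RT °T) n L N → HoweT n M N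

      data HoweV : OpenRelV ℓ where
        howeV : ∀ {n V L W} → CompV HoweT HoweV n V L → (RV °V) n L W → HoweV n V W

-- The value clause follows from compatibility and reflexivity
-- of ≾ᴴ.  For the term clause we show by induction on n that M ≾ᴴ N implies
-- eval n M Γ(≾ᴴ) ⟦N⟧, and inductivity of Γ passes this to the lub ⟦M⟧.  Each
-- step unfolds ⟦N⟧ once, lifts through η, bind and the operations, and lets
-- ≾ᴴ absorb similarity on the right; the β-case uses the substitution lemma.
--
-- Terms contain functions (argument families of operations) and we have no
-- function extensionality, so the substitution calculus holds only up to an
-- extensional syntactic equality ≈.
module Submission where

open import Defs
open import Level using () renaming (zero to lzero)
open import Data.Nat using (ℕ; zero; suc; _+_; _≤_; _≤′_; ≤′-refl; ≤′-step)
open import Data.Nat.Properties using (≤⇒≤′; m≤m+n; m≤n+m)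
open import Data.Fin using (Fin; zero; suc)
open import Data.Product using (_,_)
open import Relation.Binary.PropositionalEquality as P using (_≡_; refl; cong)
open import Relation.Binary.Core using (REL; Rel)

module SyntacticEquality (Sg : Signature) where
  open Signature Sg
  open Syntax Sg

  infix 4 _≈ᵥ_ _≈ₜ_
  mutual
    data _≈ᵥ_ : ∀ {n} → Val n → Val n → Set where
      var≈ : ∀ {n} (x : Fin n) → var x ≈ᵥ var x
      lam≈ : ∀ {n} {M M' : Term (suc n)} → M ≈ₜ M' → lam M ≈ᵥ lam M'

    data _≈ₜ_ : ∀ {n} → Term n → Term n → Set where
      ret≈ : ∀ {n} {V V' : Val n} → V ≈ᵥ V' → ret V ≈ₜ ret V'
      app≈ : ∀ {n} {V V' W W' : Val n} → V ≈ᵥ V' → W ≈ᵥ W' → app V W ≈ₜ app V' W'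
      to≈  : ∀ {n} {M M' : Term n} {N N'} → M ≈ₜ M' → N ≈ₜ N' → (M to N) ≈ₜ (M' to N')
      op≈  : ∀ {n} (o : Op) {Ms Ns : Fin (arity o) → Term n} →
             (∀ i → Ms i ≈ₜ Ns i) → op o Ms ≈ₜ op o Ns

  mutual
    ≈ᵥ-refl : ∀ {n} (V : Val n) → V ≈ᵥ V
    ≈ᵥ-refl (var x) = var≈ x
    ≈ᵥ-refl (lam M) = lam≈ (≈ₜ-refl M)

    ≈ₜ-refl : ∀ {n} (M : Term n) → M ≈ₜ M
    ≈ₜ-refl (ret V)   = ret≈ (≈ᵥ-refl V)
    ≈ₜ-refl (app V W) = app≈ (≈ᵥ-refl V) (≈ᵥ-refl W)
    ≈ₜ-refl (M to N)  = to≈ (≈ₜ-refl M) (≈ₜ-refl N)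
    ≈ₜ-refl (op o Ms) = op≈ o (λ i → ≈ₜ-refl (Ms i))

  mutual
    ≈ᵥ-sym : ∀ {n} {V W : Val n} → V ≈ᵥ W → W ≈ᵥ V
    ≈ᵥ-sym (var≈ x) = var≈ x
    ≈ᵥ-sym (lam≈ q) = lam≈ (≈ₜ-sym q)

    ≈ₜ-sym : ∀ {n} {M N : Term n} → M ≈ₜ N → N ≈ₜ M
    ≈ₜ-sym (ret≈ q)    = ret≈ (≈ᵥ-sym q)
    ≈ₜ-sym (app≈ q q') = app≈ (≈ᵥ-sym q) (≈ᵥ-sym q')
    ≈ₜ-sym (to≈ q q')  = to≈ (≈ₜ-sym q) (≈ₜ-sym q')
    ≈ₜ-sym (op≈ o qs)  = op≈ o (λ i → ≈ₜ-sym (qs i))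

  mutual
    ≈ᵥ-trans : ∀ {n} {U V W : Val n} → U ≈ᵥ V → V ≈ᵥ W → U ≈ᵥ W
    ≈ᵥ-trans (var≈ x) (var≈ .x) = var≈ x
    ≈ᵥ-trans (lam≈ q) (lam≈ r)  = lam≈ (≈ₜ-trans q r)

    ≈ₜ-trans : ∀ {n} {L M N : Term n} → L ≈ₜ M → M ≈ₜ N → L ≈ₜ N
    ≈ₜ-trans (ret≈ q)    (ret≈ r)     = ret≈ (≈ᵥ-trans q r)
    ≈ₜ-trans (app≈ q q') (app≈ r r')  = app≈ (≈ᵥ-trans q r) (≈ᵥ-trans q' r')
    ≈ₜ-trans (to≈ q q')  (to≈ r r')   = to≈ (≈ₜ-trans q r) (≈ₜ-trans q' r')
    ≈ₜ-trans (op≈ o qs)  (op≈ .o rs)  = op≈ o (λ i → ≈ₜ-trans (qs i) (rs i))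

  var-cong : ∀ {n} {x y : Fin n} → x ≡ y → var x ≈ᵥ var y
  var-cong refl = var≈ _

  ext-cong : ∀ {m n} {r r' : Fin m → Fin n} → (∀ i → r i ≡ r' i) →
             ∀ i → ext r i ≡ ext r' i
  ext-cong e zero    = refl
  ext-cong e (suc i) = cong suc (e i)

  ext-comp : ∀ {l m n} {r : Fin l → Fin m} {r' : Fin m → Fin n} {r'' : Fin l → Fin n} →
             (∀ i → r' (r i) ≡ r'' i) → ∀ i → ext r' (ext r i) ≡ ext r'' i
  ext-comp e zero    = refl
  ext-comp e (suc i) = cong suc (e i)

  mutual
    renV-cong : ∀ {m n} {r r' : Fin m → Fin n} → (∀ i → r i ≡ r' i) →
                ∀ {V V'} → V ≈ᵥ V' → renV r V ≈ᵥ renV r' V'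
    renV-cong e (var≈ x) = var-cong (e x)
    renV-cong e (lam≈ q) = lam≈ (ren-cong (ext-cong e) q)

    ren-cong : ∀ {m n} {r r' : Fin m → Fin n} → (∀ i → r i ≡ r' i) →
               ∀ {M M'} → M ≈ₜ M' → ren r M ≈ₜ ren r' M'
    ren-cong e (ret≈ q)    = ret≈ (renV-cong e q)
    ren-cong e (app≈ q q') = app≈ (renV-cong e q) (renV-cong e q')
    ren-cong e (to≈ q q')  = to≈ (ren-cong e q) (ren-cong (ext-cong e) q')
    ren-cong e (op≈ o qs)  = op≈ o (λ i → ren-cong e (qs i))

  weaken-cong : ∀ {n} {V V' : Val n} → V ≈ᵥ V' → renV suc V ≈ᵥ renV suc V'
  weaken-cong = renV-cong (λ _ → refl)

  mutual
    renV-renV : ∀ {l m n} {r : Fin l → Fin m} {r' : Fin m → Fin n} {r'' : Fin l → Fin n} →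
                (∀ i → r' (r i) ≡ r'' i) → ∀ V → renV r' (renV r V) ≈ᵥ renV r'' V
    renV-renV e (var x) = var-cong (e x)
    renV-renV e (lam M) = lam≈ (ren-ren (ext-comp e) M)

    ren-ren : ∀ {l m n} {r : Fin l → Fin m} {r' : Fin m → Fin n} {r'' : Fin l → Fin n} →
              (∀ i → r' (r i) ≡ r'' i) → ∀ M → ren r' (ren r M) ≈ₜ ren r'' M
    ren-ren e (ret V)   = ret≈ (renV-renV e V)
    ren-ren e (app V W) = app≈ (renV-renV e V) (renV-renV e W)
    ren-ren e (M to N)  = to≈ (ren-ren e M) (ren-ren (ext-comp e) N)
    ren-ren e (op o Ms) = op≈ o (λ i → ren-ren e (Ms i))

  exts-cong : ∀ {m n} {σ σ' : Fin m → Val n} → (∀ i → σ i ≈ᵥ σ' i) →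
              ∀ i → exts σ i ≈ᵥ exts σ' i
  exts-cong h zero    = var≈ zero
  exts-cong h (suc i) = weaken-cong (h i)

  mutual
    substV-cong : ∀ {m n} {σ σ' : Fin m → Val n} → (∀ i → σ i ≈ᵥ σ' i) →
                  ∀ {V V'} → V ≈ᵥ V' → substV σ V ≈ᵥ substV σ' V'
    substV-cong h (var≈ x) = h x
    substV-cong h (lam≈ q) = lam≈ (subst-cong (exts-cong h) q)

    subst-cong : ∀ {m n} {σ σ' : Fin m → Val n} → (∀ i → σ i ≈ᵥ σ' i) →
                 ∀ {M M'} → M ≈ₜ M' → subst σ M ≈ₜ subst σ' M'
    subst-cong h (ret≈ q)    = ret≈ (substV-cong h q)
    subst-cong h (app≈ q q') = app≈ (substV-cong h q) (substV-cong h q')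
    subst-cong h (to≈ q q')  = to≈ (subst-cong h q) (subst-cong (exts-cong h) q')
    subst-cong h (op≈ o qs)  = op≈ o (λ i → subst-cong h (qs i))

  []-cong : ∀ {N N' : Term 1} {V V' : Val 0} → N ≈ₜ N' → V ≈ᵥ V' → N [ V ] ≈ₜ N' [ V' ]
  []-cong p q = subst-cong (λ { zero → q ; (suc ()) }) p

  exts-ext : ∀ {l m n} {r : Fin l → Fin m} {ρ : Fin m → Val n} {ρ' : Fin l → Val n} →
             (∀ i → ρ (r i) ≈ᵥ ρ' i) → ∀ i → exts ρ (ext r i) ≈ᵥ exts ρ' i
  exts-ext h zero    = var≈ zero
  exts-ext h (suc i) = weaken-cong (h i)

  mutual
    substV-renV : ∀ {l m n} {r : Fin l → Fin m} {ρ : Fin m → Val n} {ρ' : Fin l → Val n} →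
                  (∀ i → ρ (r i) ≈ᵥ ρ' i) → ∀ V → substV ρ (renV r V) ≈ᵥ substV ρ' V
    substV-renV h (var x) = h x
    substV-renV h (lam M) = lam≈ (subst-ren (exts-ext h) M)

    subst-ren : ∀ {l m n} {r : Fin l → Fin m} {ρ : Fin m → Val n} {ρ' : Fin l → Val n} →
                (∀ i → ρ (r i) ≈ᵥ ρ' i) → ∀ M → subst ρ (ren r M) ≈ₜ subst ρ' M
    subst-ren h (ret V)   = ret≈ (substV-renV h V)
    subst-ren h (app V W) = app≈ (substV-renV h V) (substV-renV h W)
    subst-ren h (M to N)  = to≈ (subst-ren h M) (subst-ren (exts-ext h) N)
    subst-ren h (op o Ms) = op≈ o (λ i → subst-ren h (Ms i))

  -- Renaming after substitution is substitution by the renamed values.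
  -- Under a binder both sides weaken, which commute by ren-ren.
  ext-exts : ∀ {l m n} {r : Fin m → Fin n} {ρ : Fin l → Val m} {τ : Fin l → Val n} →
             (∀ i → renV r (ρ i) ≈ᵥ τ i) → ∀ i → renV (ext r) (exts ρ i) ≈ᵥ exts τ i
  ext-exts h zero = var≈ zero
  ext-exts {ρ = ρ} h (suc i) =
    ≈ᵥ-trans (renV-renV (λ _ → refl) (ρ i))
             (≈ᵥ-trans (≈ᵥ-sym (renV-renV (λ _ → refl) (ρ i))) (weaken-cong (h i)))

  mutual
    renV-substV : ∀ {l m n} {r : Fin m → Fin n} {ρ : Fin l → Val m} {τ : Fin l → Val n} →
                  (∀ i → renV r (ρ i) ≈ᵥ τ i) → ∀ V → renV r (substV ρ V) ≈ᵥ substV τ V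
    renV-substV h (var x) = h x
    renV-substV h (lam M) = lam≈ (ren-subst (ext-exts h) M)

    ren-subst : ∀ {l m n} {r : Fin m → Fin n} {ρ : Fin l → Val m} {τ : Fin l → Val n} →
                (∀ i → renV r (ρ i) ≈ᵥ τ i) → ∀ M → ren r (subst ρ M) ≈ₜ subst τ M
    ren-subst h (ret V)   = ret≈ (renV-substV h V)
    ren-subst h (app V W) = app≈ (renV-substV h V) (renV-substV h W)
    ren-subst h (M to N)  = to≈ (ren-subst h M) (ren-subst (ext-exts h) N)
    ren-subst h (op o Ms) = op≈ o (λ i → ren-subst h (Ms i))

  exts-exts : ∀ {l m n} {ρ : Fin m → Val n} {σ : Fin l → Val m} {τ : Fin l → Val n} →
              (∀ i → substV ρ (σ i) ≈ᵥ τ i) → ∀ i → substV (exts ρ) (exts σ i) ≈ᵥ exts τ i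
  exts-exts h zero = var≈ zero
  exts-exts {σ = σ} h (suc i) =
    ≈ᵥ-trans (substV-renV (λ _ → ≈ᵥ-refl _) (σ i))
             (≈ᵥ-trans (≈ᵥ-sym (renV-substV (λ _ → ≈ᵥ-refl _) (σ i))) (weaken-cong (h i)))

  mutual
    substV-substV : ∀ {l m n} {ρ : Fin m → Val n} {σ : Fin l → Val m} {τ : Fin l → Val n} →
                    (∀ i → substV ρ (σ i) ≈ᵥ τ i) → ∀ V → substV ρ (substV σ V) ≈ᵥ substV τ V
    substV-substV h (var x) = h x
    substV-substV h (lam M) = lam≈ (subst-subst (exts-exts h) M)

    subst-subst : ∀ {l m n} {ρ : Fin m → Val n} {σ : Fin l → Val m} {τ : Fin l → Val n} →
                  (∀ i → substV ρ (σ i) ≈ᵥ τ i) → ∀ M → subst ρ (subst σ M) ≈ₜ subst τ M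
    subst-subst h (ret V)   = ret≈ (substV-substV h V)
    subst-subst h (app V W) = app≈ (substV-substV h V) (substV-substV h W)
    subst-subst h (M to N)  = to≈ (subst-subst h M) (subst-subst (exts-exts h) N)
    subst-subst h (op o Ms) = op≈ o (λ i → subst-subst h (Ms i))

  exts-id : ∀ {m} {σ : Fin m → Val m} → (∀ i → σ i ≈ᵥ var i) → ∀ i → exts σ i ≈ᵥ var i
  exts-id h zero    = var≈ zero
  exts-id h (suc i) = weaken-cong (h i)

  mutual
    substV-id : ∀ {m} {σ : Fin m → Val m} → (∀ i → σ i ≈ᵥ var i) → ∀ V → substV σ V ≈ᵥ V
    substV-id h (var x) = h x
    substV-id h (lam M) = lam≈ (subst-id (exts-id h) M)

    subst-id : ∀ {m} {σ : Fin m → Val m} → (∀ i → σ i ≈ᵥ var i) → ∀ M → subst σ M ≈ₜ M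
    subst-id h (ret V)   = ret≈ (substV-id h V)
    subst-id h (app V W) = app≈ (substV-id h V) (substV-id h W)
    subst-id h (M to N)  = to≈ (subst-id h M) (subst-id (exts-id h) N)
    subst-id h (op o Ms) = op≈ o (λ i → subst-id h (Ms i))

module ChainLemmas {A : Set} (D : ωCPPO A) where
  open ωCPPO D

  chain-≤′ : ∀ (c : ℕ → A) → (∀ n → c n ⊑ c (suc n)) → ∀ {i j} → i ≤′ j → c i ⊑ c j
  chain-≤′ c p ≤′-refl       = ⊑-refl
  chain-≤′ c p (≤′-step i≤j) = ⊑-trans (chain-≤′ c p i≤j) (p _)

  chain-≤ : ∀ (c : ℕ → A) → (∀ n → c n ⊑ c (suc n)) → ∀ {i j} → i ≤ j → c i ⊑ c j
  chain-≤ c p i≤j = chain-≤′ c p (≤⇒≤′ i≤j)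

  ⨆-mono : ∀ {c d p q} → (∀ n → c n ⊑ d n) → ⨆ c p ⊑ ⨆ d q
  ⨆-mono c⊑d = ⨆-least _ _ (λ n → ⊑-trans (c⊑d n) (⨆-upper _ _ n))

  ⨆-cong : ∀ {c d p q} → (∀ n → c n ≡ d n) → ⨆ c p ≡ ⨆ d q
  ⨆-cong {c} c≡d =
    ⊑-antisym (⨆-mono (λ n → P.subst (c n ⊑_) (c≡d n) ⊑-refl))
              (⨆-mono (λ n → P.subst (_⊑ c n) (c≡d n) ⊑-refl))

  ⨆-shift : ∀ {c d p q} → (∀ n → c (suc n) ≡ d n) → ⨆ c p ≡ ⨆ d q
  ⨆-shift {c} {d} {p} {q} e =
    ⊑-antisym (⨆-least c p (λ n → ⊑-trans (p n) (P.subst (_⊑ ⨆ d q) (P.sym (e n)) (⨆-upper d q n))))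
              (⨆-least d q (λ n → P.subst (_⊑ ⨆ c p) (e n) (⨆-upper c p (suc n))))

  ⨆-const : ∀ {x p} → ⨆ (λ _ → x) p ≡ x
  ⨆-const = ⊑-antisym (⨆-least _ _ (λ _ → ⊑-refl)) (⨆-upper _ _ 0)

  ⨆-diagonal : (a : ℕ → ℕ → A) (p₁ : ∀ m n → a m n ⊑ a (suc m) n)
               (p₂ : ∀ m n → a m n ⊑ a m (suc n)) (pd : ∀ n → a n n ⊑ a (suc n) (suc n)) →
               ⨆ (λ n → a n n) pd
                 ≡ ⨆ (λ n → ⨆ (λ m → a m n) (λ m → p₁ m n)) (λ n → ⨆-mono (λ m → p₂ m n))
  ⨆-diagonal a p₁ p₂ pd =
    ⊑-antisym (⨆-least _ _ (λ n → ⊑-trans (⨆-upper _ _ n) (⨆-upper _ _ n)))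
              (⨆-least _ _ (λ n → ⨆-least _ _ (λ m → ⊑-trans (below-diagonal m n)
                                                             (⨆-upper _ _ (m + n)))))
    where
      below-diagonal : ∀ m n → a m n ⊑ a (m + n) (m + n)
      below-diagonal m n =
        ⊑-trans (chain-≤ (λ k → a k n) (λ k → p₁ k n) (m≤m+n m n))
                (chain-≤ (a (m + n)) (p₂ (m + n)) (m≤n+m n m))

module Unfolding {Sg : Signature} (𝕄 : Model Sg) where
  open Semantics 𝕄
  open Model 𝕄 using (η; _>>=_; cpo; bind-mono₁; bind-mono₂; bind-lub₁; bind-lub₂; opT; opT-lub)
  open ωCPPO (cpo (Val 0)) using (_⊑_; ⊑-refl; ⨆)
  open ChainLemmas (cpo (Val 0))
  open P.≡-Reasoning

  ⟦⟧-ret : ∀ V → ⟦ ret V ⟧ ≡ η V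
  ⟦⟧-ret V = P.trans (⨆-shift {q = λ _ → ⊑-refl} (λ _ → refl)) ⨆-const

  ⟦⟧-β : ∀ M W → ⟦ app (lam M) W ⟧ ≡ ⟦ M [ W ] ⟧
  ⟦⟧-β M W = ⨆-shift (λ _ → refl)

  ⟦⟧-op : ∀ o Ms → ⟦ op o Ms ⟧ ≡ opT o (λ i → ⟦ Ms i ⟧)
  ⟦⟧-op o Ms = P.trans (⨆-shift (λ _ → refl))
                       (P.sym (opT-lub o (λ n i → eval n (Ms i)) (λ n i → eval-chain n (Ms i))))

  -- Sequencing: the n-th approximant evaluates both M and N to depth n, so
  -- ⟦M to N⟧ is the lub of a diagonal, which continuity of bind in each
  -- argument turns into ⟦M⟧ >>= ⟦N[-]⟧.
  ⟦⟧-to : ∀ M N → ⟦ M to N ⟧ ≡ (⟦ M ⟧ >>= λ V → ⟦ N [ V ] ⟧)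
  ⟦⟧-to M N = begin
      ⟦ M to N ⟧
    ≡⟨ ⨆-shift (λ _ → refl) ⟩
      ⨆ (λ n → a n n) (λ n → eval-chain (suc n) (M to N))
    ≡⟨ ⨆-diagonal a a-mono₁ a-mono₂ _ ⟩
      ⨆ (λ n → ⨆ (λ m → a m n) (λ m → a-mono₁ m n)) (λ n → ⨆-mono (λ m → a-mono₂ m n))
    ≡⟨ ⨆-cong (λ n → P.sym (bind-lub₁ _ _ (c n))) ⟩
      ⨆ (λ n → ⟦ M ⟧ >>= c n) (λ n → bind-mono₂ ⟦ M ⟧ (c-chain n))
    ≡⟨ P.sym (bind-lub₂ ⟦ M ⟧ c c-chain) ⟩
      (⟦ M ⟧ >>= λ V → ⟦ N [ V ] ⟧)
    ∎
    where
      c : ℕ → Val 0 → TV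
      c n V = eval n (N [ V ])
      c-chain : ∀ n V → c n V ⊑ c (suc n) V
      c-chain n V = eval-chain n (N [ V ])
      a : ℕ → ℕ → TV
      a m n = eval m M >>= c n
      a-mono₁ : ∀ m n → a m n ⊑ a (suc m) n
      a-mono₁ m n = bind-mono₁ (c n) (eval-chain m M)
      a-mono₂ : ∀ m n → a m n ⊑ a m (suc n)
      a-mono₂ m n = bind-mono₂ (eval m M) (c-chain n)

module SimilarityPreorder {Sg : Signature} (𝕄 : Model Sg) (Γr : Semantics.Relator 𝕄) where
  open Semantics 𝕄
  open Relator Γr

  _≾ₜ_ : Rel (Term 0) _
  _≾ₜ_ = _≾T_ Γr

  _≾ᵥ_ : Rel (Val 0) _
  _≾ᵥ_ = _≾V_ Γr

  -- Similarity satisfies both simulation clauses, being a union of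
  -- simulations and Γ being monotone.
  ≾-sim-term : ∀ {M N} → M ≾ₜ N → Γ _≾ᵥ_ ⟦ M ⟧ ⟦ N ⟧
  ≾-sim-term (RT , RV , s , r) = Γ-mono (λ q → RT , RV , s , q) (IsAppSim.sim-term s r)

  ≾-sim-val : ∀ {V W} → V ≾ᵥ W → ∀ U → app V U ≾ₜ app W U
  ≾-sim-val (RT , RV , s , r) U = RT , RV , s , IsAppSim.sim-val s r U

  -- Identity and composites of simulations are simulations, which makes
  -- similarity reflexive and transitive.
  ≡-simulation : IsAppSim Γr (_≡_ {A = Term 0}) (_≡_ {A = Val 0})
  ≡-simulation = record { sim-term = λ { {M} refl → Γ-refl ⟦ M ⟧ }
                        ; sim-val  = λ { refl U → refl } }

  ∘-simulation : ∀ {RT RT' : Rel (Term 0) lzero} {RV RV' : Rel (Val 0) lzero} →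
                 IsAppSim Γr RT RV → IsAppSim Γr RT' RV' →
                 IsAppSim Γr (RT' ∘ᴿ RT) (RV' ∘ᴿ RV)
  ∘-simulation s s' = record
    { sim-term = λ { (_ , a , b) → Γ-comp (IsAppSim.sim-term s a) (IsAppSim.sim-term s' b) }
    ; sim-val  = λ { (W , a , b) U → app W U , IsAppSim.sim-val s a U , IsAppSim.sim-val s' b U } }

  ≾ₜ-refl : ∀ M → M ≾ₜ M
  ≾ₜ-refl M = _ , _ , ≡-simulation , refl

  ≾ᵥ-refl : ∀ V → V ≾ᵥ V
  ≾ᵥ-refl V = _ , _ , ≡-simulation , refl

  ≾ₜ-trans : ∀ {L M N} → L ≾ₜ M → M ≾ₜ N → L ≾ₜ N
  ≾ₜ-trans (_ , _ , s , r) (_ , _ , s' , r') = _ , _ , ∘-simulation s s' , (_ , r , r')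

  ≾ᵥ-trans : ∀ {U V W} → U ≾ᵥ V → V ≾ᵥ W → U ≾ᵥ W
  ≾ᵥ-trans (_ , _ , s , r) (_ , _ , s' , r') = _ , _ , ∘-simulation s s' , (_ , r , r')

module HoweSimulation {Sg : Signature} (𝕄 : Model Sg) (Γr : Semantics.Relator 𝕄)
  (ind : Semantics.Inductive 𝕄 Γr) (respΣ : Semantics.RespectsΣ 𝕄 Γr) where
  open Semantics 𝕄
  open Model 𝕄 using (T)
  open Relator Γr
  open Inductive ind
  open SyntacticEquality Sg
  open Unfolding 𝕄
  open SimilarityPreorder 𝕄 Γr

  Γ-castʳ : ∀ {ℓ} {X Y : Set} {R : REL X Y ℓ} {u : T X} {v v' : T Y} →
            v ≡ v' → Γ R u v' → Γ R u v
  Γ-castʳ {R = R} {u} e = P.subst (Γ R u) (P.sym e)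

  -- Syntactic equality is an applicative simulation, hence contained in
  -- similarity; the proof is the same approximation argument as below.
  ≈-approx : ∀ n {M M'} → M ≈ₜ M' → Γ (_≈ᵥ_ {0}) (eval n M) ⟦ M' ⟧
  ≈-approx zero    _           = Γ-⊥ _
  ≈-approx (suc n) (ret≈ q)    = Γ-castʳ (⟦⟧-ret _) (Γ-η q)
  ≈-approx (suc n) (app≈ (var≈ ()) _)
  ≈-approx (suc n) (app≈ (lam≈ q) q') = Γ-castʳ (⟦⟧-β _ _) (≈-approx n ([]-cong q q'))
  ≈-approx (suc n) (to≈ q q')  =
    Γ-castʳ (⟦⟧-to _ _) (Γ-bind _ _ (λ e → ≈-approx n ([]-cong q' e)) (≈-approx n q))
  ≈-approx (suc n) (op≈ o qs)  = Γ-castʳ (⟦⟧-op _ _) (respΣ o _ _ (λ i → ≈-approx n (qs i)))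

  ≈-simulation : IsAppSim Γr (_≈ₜ_ {0}) (_≈ᵥ_ {0})
  ≈-simulation = record { sim-term = λ q → Γ-lub _ _ _ (λ n → ≈-approx n q)
                        ; sim-val  = λ q U → app≈ q (≈ᵥ-refl U) }

  ≾ₜ-resp-≈ : ∀ {M M' N' N} → M ≈ₜ M' → M' ≾ₜ N' → N' ≈ₜ N → M ≾ₜ N
  ≾ₜ-resp-≈ a s b = ≾ₜ-trans (_ , _ , ≈-simulation , a) (≾ₜ-trans s (_ , _ , ≈-simulation , b))

  ≾ᵥ-resp-≈ : ∀ {V V' W' W} → V ≈ᵥ V' → V' ≾ᵥ W' → W' ≈ᵥ W → V ≾ᵥ W
  ≾ᵥ-resp-≈ a s b = ≾ᵥ-trans (_ , _ , ≈-simulation , a) (≾ᵥ-trans s (_ , _ , ≈-simulation , b))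

  ≾°ₜ-refl : ∀ {n} (M : Term n) → (_≾ₜ_ °T) n M M
  ≾°ₜ-refl M ρ = ≾ₜ-refl _

  ≾°ᵥ-refl : ∀ {n} (V : Val n) → (_≾ᵥ_ °V) n V V
  ≾°ᵥ-refl V ρ = ≾ᵥ-refl _

  ≾°ₜ-trans : ∀ {n L M N} → (_≾ₜ_ °T) n L M → (_≾ₜ_ °T) n M N → (_≾ₜ_ °T) n L N
  ≾°ₜ-trans a b ρ = ≾ₜ-trans (a ρ) (b ρ)

  ≾°ᵥ-trans : ∀ {n U V W} → (_≾ᵥ_ °V) n U V → (_≾ᵥ_ °V) n V W → (_≾ᵥ_ °V) n U W
  ≾°ᵥ-trans a b ρ = ≾ᵥ-trans (a ρ) (b ρ)

  ≾°ₜ-ren : ∀ {m n} (r : Fin m → Fin n) {M N} → (_≾ₜ_ °T) m M N →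
            (_≾ₜ_ °T) n (ren r M) (ren r N)
  ≾°ₜ-ren r {M} {N} o ρ = ≾ₜ-resp-≈ (subst-ren (λ _ → ≈ᵥ-refl _) M) (o (λ i → ρ (r i)))
                                    (≈ₜ-sym (subst-ren (λ _ → ≈ᵥ-refl _) N))

  ≾°ᵥ-ren : ∀ {m n} (r : Fin m → Fin n) {V W} → (_≾ᵥ_ °V) m V W →
            (_≾ᵥ_ °V) n (renV r V) (renV r W)
  ≾°ᵥ-ren r {V} {W} o ρ = ≾ᵥ-resp-≈ (substV-renV (λ _ → ≈ᵥ-refl _) V) (o (λ i → ρ (r i)))
                                    (≈ᵥ-sym (substV-renV (λ _ → ≈ᵥ-refl _) W))

  ≾°ₜ-subst : ∀ {m n} (τ : Fin m → Val n) {M N} → (_≾ₜ_ °T) m M N →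
              (_≾ₜ_ °T) n (subst τ M) (subst τ N)
  ≾°ₜ-subst τ {M} {N} o ρ = ≾ₜ-resp-≈ (subst-subst (λ _ → ≈ᵥ-refl _) M) (o (λ i → substV ρ (τ i)))
                                      (≈ₜ-sym (subst-subst (λ _ → ≈ᵥ-refl _) N))

  ≾°ᵥ-subst : ∀ {m n} (τ : Fin m → Val n) {V W} → (_≾ᵥ_ °V) m V W →
              (_≾ᵥ_ °V) n (substV τ V) (substV τ W)
  ≾°ᵥ-subst τ {V} {W} o ρ = ≾ᵥ-resp-≈ (substV-substV (λ _ → ≈ᵥ-refl _) V) (o (λ i → substV ρ (τ i)))
                                      (≈ᵥ-sym (substV-substV (λ _ → ≈ᵥ-refl _) W))

  no-vars : Fin 0 → Val 0
  no-vars ()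

  ≾°ₜ-closed : ∀ {M N} → (_≾ₜ_ °T) 0 M N → M ≾ₜ N
  ≾°ₜ-closed {M} {N} o = ≾ₜ-resp-≈ (≈ₜ-sym (subst-id (λ ()) M)) (o no-vars) (subst-id (λ ()) N)

  ≾°ᵥ-closed : ∀ {V W} → (_≾ᵥ_ °V) 0 V W → V ≾ᵥ W
  ≾°ᵥ-closed {V} {W} o = ≾ᵥ-resp-≈ (≈ᵥ-sym (substV-id (λ ()) V)) (o no-vars) (substV-id (λ ()) W)

  ≾ᵥ-open : ∀ {V W} → V ≾ᵥ W → (_≾ᵥ_ °V) 0 V W
  ≾ᵥ-open {V} {W} s ρ = ≾ᵥ-resp-≈ (substV-id (λ ()) V) s (≈ᵥ-sym (substV-id (λ ()) W))

  open Howe _≾ₜ_ _≾ᵥ_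

  mutual
    howeT-refl : ∀ {n} (M : Term n) → HoweT n M M
    howeT-refl (ret V)   = howeT (c-ret (howeV-refl V)) (≾°ₜ-refl (ret V))
    howeT-refl (app V W) = howeT (c-app (howeV-refl V) (howeV-refl W)) (≾°ₜ-refl (app V W))
    howeT-refl (M to N)  = howeT (c-to (howeT-refl M) (howeT-refl N)) (≾°ₜ-refl (M to N))
    howeT-refl (op o Ms) = howeT (c-op o (λ i → howeT-refl (Ms i))) (≾°ₜ-refl (op o Ms))

    howeV-refl : ∀ {n} (V : Val n) → HoweV n V V
    howeV-refl (var x) = howeV (c-var x) (≾°ᵥ-refl (var x))
    howeV-refl (lam M) = howeV (c-lam (howeT-refl M)) (≾°ᵥ-refl (lam M))

  howeT-≾° : ∀ {n M L N} → HoweT n M L → (_≾ₜ_ °T) n L N → HoweT n M N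
  howeT-≾° {N = N} (howeT {L = K} {N = L} c r) r' = howeT c (≾°ₜ-trans {L = K} {L} {N} r r')

  howeV-≾° : ∀ {n V U W} → HoweV n V U → (_≾ᵥ_ °V) n U W → HoweV n V W
  howeV-≾° {W = W} (howeV {L = L} {W = U} c r) r' = howeV c (≾°ᵥ-trans {U = L} {U} {W} r r')

  mutual
    howeT-ren : ∀ {m n} (r : Fin m → Fin n) {M N} → HoweT m M N → HoweT n (ren r M) (ren r N)
    howeT-ren r (howeT {L = L} {N = N} c o) = howeT (compT-ren r c) (≾°ₜ-ren r {L} {N} o)

    howeV-ren : ∀ {m n} (r : Fin m → Fin n) {V W} → HoweV m V W → HoweV n (renV r V) (renV r W)
    howeV-ren r (howeV {L = L} {W = W} c o) = howeV (compV-ren r c) (≾°ᵥ-ren r {L} {W} o)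

    compT-ren : ∀ {m n} (r : Fin m → Fin n) {M N} → CompT HoweT HoweV m M N →
                CompT HoweT HoweV n (ren r M) (ren r N)
    compT-ren r (c-ret h)    = c-ret (howeV-ren r h)
    compT-ren r (c-app h h') = c-app (howeV-ren r h) (howeV-ren r h')
    compT-ren r (c-to h h')  = c-to (howeT-ren r h) (howeT-ren (ext r) h')
    compT-ren r (c-op o hs)  = c-op o (λ i → howeT-ren r (hs i))

    compV-ren : ∀ {m n} (r : Fin m → Fin n) {V W} → CompV HoweT HoweV m V W →
                CompV HoweT HoweV n (renV r V) (renV r W)
    compV-ren r (c-var x) = c-var (r x)
    compV-ren r (c-lam h) = c-lam (howeT-ren (ext r) h)

  exts-howe : ∀ {m n} {σ σ' : Fin m → Val n} → (∀ i → HoweV n (σ i) (σ' i)) →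
              ∀ i → HoweV (suc n) (exts σ i) (exts σ' i)
  exts-howe hs zero    = howeV-refl (var zero)
  exts-howe hs (suc i) = howeV-ren suc (hs i)

  -- At a variable the
  -- substituted values are related directly, and the open-similarity part
  -- is pushed through σ'.
  mutual
    howeT-subst : ∀ {m n} {σ σ' : Fin m → Val n} → (∀ i → HoweV n (σ i) (σ' i)) →
                  ∀ {M N} → HoweT m M N → HoweT n (subst σ M) (subst σ' N)
    howeT-subst {σ' = σ'} hs (howeT {L = L} {N = N} c o) =
      howeT (compT-subst hs c) (≾°ₜ-subst σ' {L} {N} o)

    howeV-subst : ∀ {m n} {σ σ' : Fin m → Val n} → (∀ i → HoweV n (σ i) (σ' i)) →
                  ∀ {V W} → HoweV m V W → HoweV n (substV σ V) (substV σ' W)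
    howeV-subst {σ' = σ'} hs (howeV {W = W} (c-var x) o) =
      howeV-≾° (hs x) (≾°ᵥ-subst σ' {var x} {W} o)
    howeV-subst {σ' = σ'} hs (howeV {L = L} {W = W} (c-lam h) o) =
      howeV (c-lam (howeT-subst (exts-howe hs) h)) (≾°ᵥ-subst σ' {L} {W} o)

    compT-subst : ∀ {m n} {σ σ' : Fin m → Val n} → (∀ i → HoweV n (σ i) (σ' i)) →
                  ∀ {M N} → CompT HoweT HoweV m M N → CompT HoweT HoweV n (subst σ M) (subst σ' N)
    compT-subst hs (c-ret h)    = c-ret (howeV-subst hs h)
    compT-subst hs (c-app h h') = c-app (howeV-subst hs h) (howeV-subst hs h')
    compT-subst hs (c-to h h')  = c-to (howeT-subst hs h) (howeT-subst (exts-howe hs) h')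
    compT-subst hs (c-op o hs') = c-op o (λ i → howeT-subst hs (hs' i))

  howe-[] : ∀ {N N' V V'} → HoweT 1 N N' → HoweV 0 V V' → HoweT 0 (N [ V ]) (N' [ V' ])
  howe-[] h hv = howeT-subst (λ { zero → hv ; (suc ()) }) h

  Γ-howe-≾ : ∀ {u L N} → Γ (HoweV 0) u ⟦ L ⟧ → Γ _≾ᵥ_ ⟦ L ⟧ ⟦ N ⟧ → Γ (HoweV 0) u ⟦ N ⟧
  Γ-howe-≾ a b = Γ-mono (λ { (_ , h , s) → howeV-≾° h (≾ᵥ-open s) }) (Γ-comp a b)

  -- A Howe step M ≾̂ᴴ L ≾° N is handled by the compatible case for L
  -- followed by Γ-howe-≾; in the β-case the similarity L ≾ N of
  -- λ-abstractions is first turned into one of their applications.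
  mutual
    howe-approx : ∀ n {M N} → HoweT 0 M N → Γ (HoweV 0) (eval n M) ⟦ N ⟧
    howe-approx zero    _           = Γ-⊥ _
    howe-approx (suc n) (howeT c o) = Γ-howe-≾ (compatible-approx n c) (≾-sim-term (≾°ₜ-closed o))

    compatible-approx : ∀ n {M L} → CompT HoweT HoweV 0 M L → Γ (HoweV 0) (eval (suc n) M) ⟦ L ⟧
    compatible-approx n (c-ret h) = Γ-castʳ (⟦⟧-ret _) (Γ-η h)
    compatible-approx n (c-app (howeV (c-var ()) _) _)
    compatible-approx n (c-app {W' = W'} (howeV (c-lam hM) o) hW) =
      Γ-howe-≾ (Γ-castʳ (⟦⟧-β _ _) (howe-approx n (howe-[] hM hW)))
               (≾-sim-term (≾-sim-val (≾°ᵥ-closed o) W'))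
    compatible-approx n (c-to hM hN) =
      Γ-castʳ (⟦⟧-to _ _) (Γ-bind _ _ (λ hV → howe-approx n (howe-[] hN hV)) (howe-approx n hM))
    compatible-approx n (c-op o hs) =
      Γ-castʳ (⟦⟧-op _ _) (respΣ o _ _ (λ i → howe-approx n (hs i)))

  howe-simulation : IsAppSim Γr (HoweT zero) (HoweV zero)
  howe-simulation = record
    { sim-term = λ h → Γ-lub _ _ _ (λ n → howe-approx n h)
    ; sim-val  = λ {_} {W} h U → howeT (c-app h (howeV-refl U)) (≾°ₜ-refl (app W U)) }

mainTheorem4 : (Sg : Signature) (𝕄 : Model Sg) (Γr : Semantics.Relator 𝕄) →
    Semantics.Inductive 𝕄 Γr → Semantics.RespectsΣ 𝕄 Γr →
    Semantics.IsAppSim 𝕄 Γr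
    (Semantics.Howe.HoweT 𝕄 (Semantics._≾T_ 𝕄 Γr) (Semantics._≾V_ 𝕄 Γr) zero)
    (Semantics.Howe.HoweV 𝕄 (Semantics._≾T_ 𝕄 Γr) (Semantics._≾V_ 𝕄 Γr) zero)
mainTheorem4 Sg 𝕄 Γr ind respΣ = HoweSimulation.howe-simulation 𝕄 Γr ind respΣ
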